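{- Let $P$ be a poset and $v$ an assignment of variables to elements of $P$. Then for all $n\in\omega$ and $1\leq k,r,s<\omega$: $P,v\models\phi_{krsn}(\vec{x}_k,y)$ if and only if $\exists$ has an $n$-strategy for the $(\alpha,\beta)$-game on $P$ with starting position $(\{v(x_1),\dots,v(x_k)\},\{v(y)\})$ for all $2\leq\alpha\leq r+1$ and $2\leq\beta\leq s+1$.
   Context: The $(\alpha,\beta)$-game on $P$ with starting position $(U_0,V)$ ($U_0,V\subseteq P$) is played by $\forall$ and $\exists$ in rounds $0,1,2,\dots$; a set $U$ starts as $U_0$. $\forall$ wins in round $n$ if $U\cap V\neq\emptyset$ at the beginning of round $n$. In each round $\forall$ makes one of the moves: (1) pick $b\in P$ with $b\geq a$ for some $a\in U$; $\exists$ must add $b$ to $U$. (2) pick $A\subseteq U$ with $|A|<\alpha$ such that $\bigwedge A$ exists in $P$; $\exists$ must add $\bigwedge A$ to $U$. (3) pick $B\subseteq P$ with $|B|<\beta$ such that $\bigvee B$ exists in $P$ and lies in $U$; $\exists$ must choose some $b\in B$ and add it to $U$. $\exists$ has an $n$-strategy if she can guarantee that $\forall$ does not win in any round $\leq n$. Formulas in the signature $\{\leq\}$; for an assignment $v$ write $v[\vec{x}_k]=\{v(x_1),\dots,v(x_k)\}$. For $1\leq k<\omega$: $J_k(\vec{x}_k,y)$ holds iff $v(y)=\bigvee v[\vec{x}_k]$, $M_k(\vec{x}_k,y)$ holds iff $v(y)=\bigwedge v[\vec{x}_k]$; $C_k(\vec{x}_k,y)$ is $\bigvee_{i=1}^k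 y=x_i$ and $D_k=\neg C_k$; $C_{km}(\vec{x}_k,\vec{y}_m)$ holds iff $v[\vec{y}_m]\subseteq v[\vec{x}_k]$. Put $\sigma_k(\vec{x}_k,c)=\exists z(C_k(\vec{x}_k,z)\wedge z\leq c)$, $\tau_{kr}(\vec{x}_k,\vec{a}_r,c)=C_{kr}(\vec{x}_k,\vec{a}_r)\wedge M_r(\vec{a}_r,c)$, $\rho_{ks}(\vec{x}_k,\vec{b}_s)=\exists z(C_k(\vec{x}_k,z)\wedge J_s(\vec{b}_s,z))$. Recursively $\phi_{krs0}(\vec{x}_k,y)=D_k(\vec{x}_k,y)$ and $\phi_{krs(n+1)}(\vec{x}_k,y)=\forall\vec{a}_r\forall\vec{b}_s\forall c\Big(\big(\sigma_k(\vec{x}_k,c)\rightarrow\phi_{(k+1)rsn}(\vec{x}_k,c,y)\big)\wedge\big(\tau_{kr}(\vec{x}_k,\vec{a}_r,c)\rightarrow\phi_{(k+1)rsn}(\vec{x}_k,c,y)\big)\wedge\big(\rho_{ks}(\vec{x}_k,\vec{b}_s)\rightarrow\bigvee_{i=1}^s\phi_{(k+1)rsn}(\vec{x}_k,b_i,y)\big)\Big)$. -}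

module Defs where

open import Level using (Level; _⊔_)
open import Data.Nat using (ℕ; zero; suc; _<_)
open import Data.Fin using (Fin; fromℕ; inject₁; toℕ)
open import Data.Fin as F using ()
open import Data.Product using (Σ; ∃; ∃-syntax; _×_; _,_)
open import Data.Sum using (_⊎_)
open import Data.Empty using (⊥)
open import Relation.Nullary using (¬_)
open import Relation.Binary.Bundles using (Poset)

module _ {c ℓ₁ ℓ₂ : Level} (P : Poset c ℓ₁ ℓ₂) where
  open Poset P renaming (Carrier to C)

  Subset : Set (c ⊔ Level.suc ℓ₁)
  Subset = C → Set ℓ₁

  _∪｛_｝ : Subset → C → Subset
  (U ∪｛ b ｝) x = U x ⊎ (x ≈ b)

  ｛_｝ : {k : ℕ} → (Fin k → C) → Subset
  ｛ f ｝ x = ∃[ i ] (x ≈ f i)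

  Disjoint : Subset → Subset → Set (c ⊔ ℓ₁)
  Disjoint U V = ∀ x → U x → V x → ⊥

  IsMeet : {k : ℕ} → (Fin k → C) → C → Set (c ⊔ ℓ₂)
  IsMeet f g = (∀ i → g ≤ f i) × (∀ z → (∀ i → z ≤ f i) → z ≤ g)

  IsJoin : {k : ℕ} → (Fin k → C) → C → Set (c ⊔ ℓ₂)
  IsJoin f g = (∀ i → f i ≤ g) × (∀ z → (∀ i → f i ≤ z) → g ≤ z)

  -- The (α,β)-game.  α, β are (finite) cardinals, here natural numbers.
  -- A subset A with |A| < α is given as the image of a family
  -- Fin j → C with j < α (repetitions allowed).
  -- Strategy α β V n U : ∃ has an n-strategy for the (α,β)-game with
  -- current position (U,V), i.e. ∀ cannot win in rounds 0,…,n.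
  -- If ∃ has no legal reply (empty B in move (3)) she loses.
  Strategy : ℕ → ℕ → Subset → ℕ → Subset → Set (c ⊔ ℓ₁ ⊔ ℓ₂)
  Strategy α β V zero U = Level.Lift (c ⊔ ℓ₁ ⊔ ℓ₂) (Disjoint U V)
  Strategy α β V (suc n) U =
    Level.Lift (c ⊔ ℓ₁ ⊔ ℓ₂) (Disjoint U V)
    × (∀ a b → U a → a ≤ b → Strategy α β V n (U ∪｛ b ｝))
    × (∀ j (A : Fin j → C) → j < α → (∀ i → U (A i)) →
         ∀ g → IsMeet A g → Strategy α β V n (U ∪｛ g ｝))
    × (∀ j (B : Fin j → C) → j < β → ∀ g → IsJoin B g → U g →
         ∃[ i ] Strategy α β V n (U ∪｛ B i ｝))

  HasNStrategy : (α β n : ℕ) → Subset → Subset → Set (c ⊔ ℓ₁ ⊔ ℓ₂)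
  HasNStrategy α β n U₀ V = Strategy α β V n U₀

  -- Semantics of the formulas (Tarskian evaluation in P of the
  -- formulas defined in the paper), taking the tuple of values of the
  -- free variables.

  snoc : {k : ℕ} → (Fin k → C) → C → Fin (suc k) → C
  snoc {zero}  xs c F.zero    = c
  snoc {suc k} xs c F.zero    = xs F.zero
  snoc {suc k} xs c (F.suc i) = snoc (λ j → xs (F.suc j)) c i

  J : {k : ℕ} → (Fin k → C) → C → Set (c ⊔ ℓ₂)
  J xs y = IsJoin xs y

  M : {k : ℕ} → (Fin k → C) → C → Set (c ⊔ ℓ₂)
  M xs y = IsMeet xs y

  Cf : {k : ℕ} → (Fin k → C) → C → Set ℓ₁
  Cf xs y = ∃[ i ] (y ≈ xs i)

  Df : {k : ℕ} → (Fin k → C) → C → Set ℓ₁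
  Df xs y = ¬ Cf xs y

  Cfm : {k m : ℕ} → (Fin k → C) → (Fin m → C) → Set ℓ₁
  Cfm xs ys = ∀ j → Cf xs (ys j)

  σ : {k : ℕ} → (Fin k → C) → C → Set (c ⊔ ℓ₁ ⊔ ℓ₂)
  σ xs c = Σ C λ z → Cf xs z × z ≤ c

  τ : {k r : ℕ} → (Fin k → C) → (Fin r → C) → C → Set (c ⊔ ℓ₁ ⊔ ℓ₂)
  τ xs as c = Cfm xs as × M as c

  ρ : {k s : ℕ} → (Fin k → C) → (Fin s → C) → Set (c ⊔ ℓ₁ ⊔ ℓ₂)
  ρ xs bs = Σ C λ z → Cf xs z × J bs z

  φ : (k r s n : ℕ) → (Fin k → C) → C → Set (c ⊔ ℓ₁ ⊔ ℓ₂)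
  φ k r s zero    xs y = Level.Lift (c ⊔ ℓ₁ ⊔ ℓ₂) (Df xs y)
  φ k r s (suc n) xs y =
    ∀ (as : Fin r → C) (bs : Fin s → C) (c : C) →
      (σ xs c → φ (suc k) r s n (snoc xs c) y)
      × (τ xs as c → φ (suc k) r s n (snoc xs c) y)
      × (ρ xs bs → ∃[ i ] φ (suc k) r s n (snoc xs (bs i)) y)

module Submission where

-- The proof is a simultaneous induction on n, matching the three
-- conjuncts of φ with the three moves of ∀: σ with move (1), τ with
-- move (2), ρ with move (3); appending c to x⃗ corresponds to adding c
-- to the position U.  Three general facts make this work:
--   * strategies are monotone: shrinking U, α or β only helps ∃, so the
--     single game with α = r+1, β = s+1 is the hardest one;
--   * the image of snoc x⃗ c is {x⃗} ∪ {c};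
--   * a meet (join) of a family of size j+1 ≤ r is also the meet (join)
--     of an r-indexed family with the same image, which is how a short
--     move of ∀ is answered by the fixed-arity quantifiers of φ.
-- Moves of ∀ with an empty family are handled through σ: the empty meet
-- is a top element above x₁, and the empty join is a bottom element of
-- U, below v(y), so it would force v(y) into the position.

open import Defs
open import Level using (Level; _⊔_; lift; lower)
open import Data.Nat using (ℕ; zero; suc; _≤_; s≤s)
open import Data.Nat.Properties using (≤-trans; ≤-refl; ≤-pred)
open import Data.Fin as F using (Fin; fromℕ; inject₁; inject≤)
open import Data.Product using (∃-syntax; _,_; proj₁; proj₂)
open import Data.Sum using (_⊎_; inj₁; inj₂)
open import Data.Empty using (⊥-elim)
open import Function using (_∘_)
open import Relation.Binary.Bundles using (Poset)
open import Relation.Binary.PropositionalEquality using (_≡_; refl; cong; subst) renaming (sym to ≡-sym)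
open import Relation.Unary using (_⊆_)
open import Function.Bundles using (_⇔_; mk⇔)

squash : {r j : ℕ} → Fin r → Fin (suc j)
squash F.zero = F.zero
squash {j = zero} (F.suc i) = F.zero
squash {j = suc j} (F.suc i) = F.suc (squash i)

squash-inject≤ : {r j : ℕ} (i : Fin (suc j)) (le : suc j ≤ r) →
                 squash {r} (inject≤ i le) ≡ i
squash-inject≤ {suc r} F.zero le = refl
squash-inject≤ {suc r} {suc j} (F.suc i) (s≤s le) = cong F.suc (squash-inject≤ i le)

module _ {c ℓ₁ ℓ₂ : Level} (P : Poset c ℓ₁ ℓ₂) where
  open Poset P using (_≈_) renaming (Carrier to C; _≤_ to _⊑_; refl to ⊑-refl)
  open Poset.Eq P using () renaming (refl to ≈-refl; sym to ≈-sym; trans to ≈-trans)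

  -- Reindexing along squash keeps the image of a family, so meets and
  -- joins persist; this lets φ's r-ary (s-ary) quantifier see any
  -- nonempty family of smaller size.
  module _ {r j : ℕ} (le : suc j ≤ r) (A : Fin (suc j) → C) where

    all-squash : (R : C → Set ℓ₂) → (∀ i → R (A (squash {r} i))) → ∀ i → R (A i)
    all-squash R h i = subst (R ∘ A) (squash-inject≤ i le) (h (inject≤ i le))

    meet-squash : ∀ {g} → IsMeet P A g → IsMeet P (A ∘ squash {r}) g
    meet-squash (lb , glb) = lb ∘ squash , λ z → glb z ∘ all-squash (z ⊑_)

    join-squash : ∀ {g} → IsJoin P A g → IsJoin P (A ∘ squash {r}) g
    join-squash (ub , lub) = ub ∘ squash , λ z → lub z ∘ all-squash (_⊑ z)

  module _ {k : ℕ} (xs : Fin k → C) (b : C) where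

    snoc-inject₁ : ∀ i → snoc P xs b (inject₁ i) ≡ xs i
    snoc-inject₁ = go xs
      where
      go : ∀ {k} (xs : Fin k → C) i → snoc P xs b (inject₁ i) ≡ xs i
      go {suc k} xs F.zero = refl
      go {suc k} xs (F.suc i) = go (xs ∘ F.suc) i

    snoc-fromℕ : snoc P xs b (fromℕ k) ≡ b
    snoc-fromℕ = go xs
      where
      go : ∀ {k} (xs : Fin k → C) → snoc P xs b (fromℕ k) ≡ b
      go {zero} xs = refl
      go {suc k} xs = go (xs ∘ F.suc)

    snoc-cases : ∀ i → (∃[ i′ ] snoc P xs b i ≡ xs i′) ⊎ (snoc P xs b i ≡ b)
    snoc-cases = go xs
      where
      go : ∀ {k} (xs : Fin k → C) i →
           (∃[ i′ ] snoc P xs b i ≡ xs i′) ⊎ (snoc P xs b i ≡ b)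
      go {zero} xs F.zero = inj₂ refl
      go {suc k} xs F.zero = inj₁ (F.zero , refl)
      go {suc k} xs (F.suc i) with go (xs ∘ F.suc) i
      ... | inj₁ (i′ , e) = inj₁ (F.suc i′ , e)
      ... | inj₂ e = inj₂ e

    ∪⊆image-snoc : _∪｛_｝ P (｛_｝ P xs) b ⊆ ｛_｝ P (snoc P xs b)
    ∪⊆image-snoc {x} (inj₁ (i , x≈)) = inject₁ i , subst (x ≈_) (≡-sym (snoc-inject₁ i)) x≈
    ∪⊆image-snoc {x} (inj₂ x≈) = fromℕ k , subst (x ≈_) (≡-sym snoc-fromℕ) x≈

    image-snoc⊆∪ : ｛_｝ P (snoc P xs b) ⊆ _∪｛_｝ P (｛_｝ P xs) b
    image-snoc⊆∪ {x} (i , x≈) with snoc-cases i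
    ... | inj₁ (i′ , e) = inj₁ (i′ , subst (x ≈_) e x≈)
    ... | inj₂ e = inj₂ (subst (x ≈_) e x≈)

  ∪-mono : ∀ {U U′} b → U ⊆ U′ → _∪｛_｝ P U b ⊆ _∪｛_｝ P U′ b
  ∪-mono b h (inj₁ u) = inj₁ (h u)
  ∪-mono b h (inj₂ e) = inj₂ e

  module _ {V : Subset P} where

    strategy-disjoint : ∀ {α β} n {U} → Strategy P α β V n U → Disjoint P U V
    strategy-disjoint zero (lift d) = d
    strategy-disjoint (suc n) (lift d , _) = d

    -- Fewer allowed moves for ∀ and a smaller position only help ∃.
    strategy-mono : ∀ {α β α′ β′} → α′ ≤ α → β′ ≤ β → ∀ n {U U′} → U′ ⊆ U →
                    Strategy P α β V n U → Strategy P α′ β′ V n U′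
    strategy-mono α≤ β≤ zero U′⊆U (lift d) = lift (λ x u′ → d x (U′⊆U u′))
    strategy-mono {α} {β} {α′} {β′} α≤ β≤ (suc n) {U} {U′} U′⊆U (lift d , up , meet , join) =
        lift (λ x u′ → d x (U′⊆U u′))
      , (λ a b u′ a≤b → continue b (up a b (U′⊆U u′) a≤b))
      , (λ j A j< A⊆ g isMeet →
           continue g (meet j A (≤-trans j< α≤) (U′⊆U ∘ A⊆) g isMeet))
      , (λ j B j< g isJoin g∈ →
           let (i , st) = join j B (≤-trans j< β≤) g isJoin (U′⊆U g∈)
           in i , continue (B i) st)
      where
      continue : ∀ b → Strategy P α β V n (_∪｛_｝ P U b) →
                 Strategy P α′ β′ V n (_∪｛_｝ P U′ b)
      continue b = strategy-mono α≤ β≤ n (∪-mono {U′} {U} b U′⊆U)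

  -- The three conjuncts of φ_{krs(n+1)} used separately.  The tuple xs is
  -- nonempty, so its first entry fills the quantifiers a conjunct ignores.
  module _ {r s : ℕ} {k n : ℕ} {xs : Fin (suc k) → C} {y : C}
           (h : φ P (suc k) r s (suc n) xs y) where
    private
      x₁ = xs F.zero

    φ-up : ∀ {c} → σ P xs c → φ P (suc (suc k)) r s n (snoc P xs c) y
    φ-up {c} = proj₁ (h (λ _ → x₁) (λ _ → x₁) c)

    φ-meet : ∀ {as c} → τ P xs as c → φ P (suc (suc k)) r s n (snoc P xs c) y
    φ-meet {as} {c} = proj₁ (proj₂ (h as (λ _ → x₁) c))

    φ-join : ∀ {bs} → ρ P xs bs → ∃[ i ] φ P (suc (suc k)) r s n (snoc P xs (bs i)) y
    φ-join {bs} = proj₂ (proj₂ (h (λ _ → x₁) bs x₁))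

  module Equivalence (r s : ℕ) (r≥1 : 1 ≤ r) (s≥1 : 1 ≤ s) where

    Target : C → Subset P
    Target y = ｛_｝ P (λ (_ : Fin 1) → y)

    Survives : ∀ {k} → ℕ → (Fin k → C) → C → Set (c ⊔ ℓ₁ ⊔ ℓ₂)
    Survives n xs y = ∀ α β → 2 ≤ α → α ≤ suc r → 2 ≤ β → β ≤ suc s →
                      Strategy P α β (Target y) n (｛_｝ P xs)

    hardest : ∀ {k n} {xs : Fin k → C} {y} → Survives n xs y →
              Strategy P (suc r) (suc s) (Target y) n (｛_｝ P xs)
    hardest H = H (suc r) (suc s) (s≤s r≥1) ≤-refl (s≤s s≥1) ≤-refl

    sound : ∀ n {k} (xs : Fin (suc k) → C) y → φ P (suc k) r s n xs y → Survives n xs y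
    complete : ∀ n {k} (xs : Fin (suc k) → C) y → Survives n xs y → φ P (suc k) r s n xs y

    sound zero xs y (lift y∉) α β _ _ _ _ =
      lift (λ x (i , x≈) (_ , x≈y) → y∉ (i , ≈-trans (≈-sym x≈y) x≈))
    sound (suc n) {k} xs y h α β α≥2 α≤ β≥2 β≤ = lift disjoint , up , meet , join
      where
      next : ∀ b → φ P (suc (suc k)) r s n (snoc P xs b) y →
             Strategy P α β (Target y) n (_∪｛_｝ P (｛_｝ P xs) b)
      next b ψ = strategy-mono ≤-refl ≤-refl n (∪⊆image-snoc xs b)
                   (sound n (snoc P xs b) y ψ α β α≥2 α≤ β≥2 β≤)

      x₁∈ : ｛_｝ P xs (xs F.zero)
      x₁∈ = F.zero , ≈-refl

      disjoint : Disjoint P (｛_｝ P xs) (Target y)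
      disjoint x u = strategy-disjoint n (next _ (φ-up h (_ , x₁∈ , ⊑-refl))) x (inj₁ u)

      up : ∀ a b → ｛_｝ P xs a → a ⊑ b →
           Strategy P α β (Target y) n (_∪｛_｝ P (｛_｝ P xs) b)
      up = λ a b a∈ a≤b → next b (φ-up h (a , a∈ , a≤b))

      -- Move (2) is answered by τ on the squashed family; the empty meet
      -- is a top element, reached through σ from x₁.
      meet : ∀ j (A : Fin j → C) → suc j ≤ α → (∀ i → ｛_｝ P xs (A i)) →
             ∀ g → IsMeet P A g → Strategy P α β (Target y) n (_∪｛_｝ P (｛_｝ P xs) g)
      meet = λ where
        zero A _ _ g (_ , glb) → next g (φ-up h (_ , x₁∈ , glb _ (λ ())))
        (suc j) A j< A⊆ g isMeet →
          let le = ≤-pred (≤-trans j< α≤)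
          in next g (φ-meet h (A⊆ ∘ squash , meet-squash le A isMeet))

      -- Move (3) is answered by ρ on the squashed family; an empty join
      -- in the position lies below y, so ∀ could add y and win.
      join : ∀ j (B : Fin j → C) → suc j ≤ β → ∀ g → IsJoin P B g → ｛_｝ P xs g →
             ∃[ i ] Strategy P α β (Target y) n (_∪｛_｝ P (｛_｝ P xs) (B i))
      join = λ where
        zero B _ g (_ , lub) g∈ →
          ⊥-elim (strategy-disjoint n (next y (φ-up h (g , g∈ , lub y (λ ()))))
                    y (inj₂ ≈-refl) (F.zero , ≈-refl))
        (suc j) B j< g isJoin g∈ →
          let le = ≤-pred (≤-trans j< β≤)
              (i , ψ) = φ-join h (g , g∈ , join-squash le B isJoin)
          in squash i , next (B (squash i)) ψ

    complete zero xs y H =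
      lift (λ y∈ → lower (hardest H) y y∈ (F.zero , ≈-refl))
    complete (suc n) {k} xs y H as bs c = up , meet , join
      where
      previous : ∀ b → Strategy P (suc r) (suc s) (Target y) n (_∪｛_｝ P (｛_｝ P xs) b) →
                 φ P (suc (suc k)) r s n (snoc P xs b) y
      previous b st = complete n (snoc P xs b) y
        (λ α β _ α≤ _ β≤ → strategy-mono α≤ β≤ n (image-snoc⊆∪ xs b) st)

      up : σ P xs c → φ P (suc (suc k)) r s n (snoc P xs c) y
      up (z , z∈ , z≤c) = let _ , moveUp , _ = hardest H in previous c (moveUp z c z∈ z≤c)

      meet : τ P xs as c → φ P (suc (suc k)) r s n (snoc P xs c) y
      meet (as⊆ , isMeet) = let _ , _ , moveMeet , _ = hardest H
        in previous c (moveMeet r as ≤-refl as⊆ c isMeet)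

      join : ρ P xs bs → ∃[ i ] φ P (suc (suc k)) r s n (snoc P xs (bs i)) y
      join (z , z∈ , isJoin) =
        let _ , _ , _ , moveJoin = hardest H
            (i , st) = moveJoin s bs ≤-refl z isJoin z∈
        in i , previous (bs i) st

lemma5p3 : {c ℓ₁ ℓ₂ : Level} (P : Poset c ℓ₁ ℓ₂) (v : ℕ → Poset.Carrier P)
    (n k r s : ℕ) → 1 ≤ k → 1 ≤ r → 1 ≤ s →
    (xs : Fin k → ℕ) (y : ℕ) →
    φ P k r s n (λ i → v (xs i)) (v y)
    ⇔ (∀ (α β : ℕ) → 2 ≤ α → α ≤ suc r → 2 ≤ β → β ≤ suc s →
    HasNStrategy P α β n (｛_｝ P (λ i → v (xs i)))
    (｛_｝ P (λ (_ : Fin 1) → v y)))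
lemma5p3 P v n (suc k) r s _ r≥1 s≥1 xs y =
  mk⇔ (sound n (v ∘ xs) (v y)) (complete n (v ∘ xs) (v y))
  where open Equivalence P r s r≥1 s≥1
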